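{- The map $p_4:\mathrm{Frieze}(4)\to\mathrm{YFrieze}(4)$ is bijective.
   Context: A (Coxeter) frieze pattern is an array of staggered infinite rows of numbers satisfying the unimodular rule $WE-NS=1$ for every diamond with $N$ above, $S$ below, $W$ and $E$ left and right; its initial row (row $0$) consists of $0$'s and row $1$ consists of $1$'s. It is closed of width $n$ if row $n+2$ consists of $1$'s and row $n+3$ of $0$'s, with exactly $n$ rows strictly between the two rows of $1$'s; it is arithmetic if all rows other than the rows of $0$'s consist of positive integers. $\mathrm{Frieze}(n)$ is the set of arithmetic frieze patterns of width $n$. A Y-frieze pattern of width $n$ is an array of rational numbers $y_{i,j}$, $i=0,\dots,n+1$, $j\in\mathbb{Z}$, in staggered rows (entry $y_{i,j}$ at horizontal position $j+i/2$), with rows $0$ and $n+1$ entirely $0$, no row in between entirely $0$, and $y_{i,j}y_{i,j+1}=(1+y_{i-1,j+1})(1+y_{i+1,j})$ for $1\le i\le n$; it is arithmetic if all entries in rows $1,\dots,n$ are positive integers. $\mathrm{YFrieze}(n)$ is the set of arithmetic Y-frieze patterns of width $n$. A Y-frieze pattern is determined by its first row via the diamond rule. The map $p_n:\mathrm{Frieze}(n)\to\mathrm{YFrieze}(n)$ (known to be well defined, by a result of de St. Germain) sends a frieze $F$ to the Y-frieze pattern whose first row equals the row of $F$ two rows below the row of $1$'s; equivalently, if $(m_j)_{j\in\mathbb{Z}}$ are the consecutive entries of the row of $F$ directly below the row of $1$'s, the first row of $p_n(F)$ is $(m_jm_{j+1}-1)_{j\in\mathbb{Z}}$. -}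

module Defs where

open import Data.Nat as ℕ using (ℕ; suc; _∸_)
open import Data.Integer using (ℤ; _+_; _-_; _*_; _<_; 0ℤ; 1ℤ)
open import Data.Product using (Σ; ∃; _×_; _,_)
open import Relation.Binary.PropositionalEquality using (_≡_)

-- Arrays are functions  a : ℕ → ℤ → ℤ ,  a i j = entry in row i, column j,
-- placed at horizontal position j + i/2.  For a diamond with W = a i j,
-- E = a i (j+1), the top entry is a (i-1) (j+1) and the bottom is a (i+1) j.

record IsFrieze (n : ℕ) (f : ℕ → ℤ → ℤ) : Set where
  field
    row0     : ∀ j → f 0 j ≡ 0ℤ
    row1     : ∀ j → f 1 j ≡ 1ℤ
    rowOnes  : ∀ j → f (n ℕ.+ 2) j ≡ 1ℤ
    rowZeros : ∀ j → f (n ℕ.+ 3) j ≡ 0ℤ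
    unimod   : ∀ i j → 1 ℕ.≤ i → i ℕ.≤ n ℕ.+ 2 →
               f i j * f i (j + 1ℤ) - f (i ∸ 1) (j + 1ℤ) * f (suc i) j ≡ 1ℤ
    positive : ∀ i j → 1 ℕ.≤ i → i ℕ.≤ n ℕ.+ 2 → 0ℤ < f i j

Frieze : ℕ → Set
Frieze n = Σ (ℕ → ℤ → ℤ) (IsFrieze n)

_≈F_ : ∀ {n} → Frieze n → Frieze n → Set
_≈F_ {n} (f , _) (g , _) = ∀ i j → i ℕ.≤ n ℕ.+ 3 → f i j ≡ g i j

-- Arithmetic Y-frieze pattern of width n: rows 0 .. n+1.  Arithmetic
-- Y-friezes have integer entries, so ℤ-valued arrays suffice.
record IsYFrieze (n : ℕ) (y : ℕ → ℤ → ℤ) : Set where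
  field
    row0     : ∀ j → y 0 j ≡ 0ℤ
    rowLast  : ∀ j → y (suc n) j ≡ 0ℤ
    diamond  : ∀ i j → 1 ℕ.≤ i → i ℕ.≤ n →
               y i j * y i (j + 1ℤ) ≡ (1ℤ + y (i ∸ 1) (j + 1ℤ)) * (1ℤ + y (suc i) j)
    positive : ∀ i j → 1 ℕ.≤ i → i ℕ.≤ n → 0ℤ < y i j

YFrieze : ℕ → Set
YFrieze n = Σ (ℕ → ℤ → ℤ) (IsYFrieze n)

_≈Y_ : ∀ {n} → YFrieze n → YFrieze n → Set
_≈Y_ {n} (y , _) (z , _) = ∀ i j → i ℕ.≤ suc n → y i j ≡ z i j

-- The graph of p_n: Y = p_n(F) iff the first row of Y is the row of F two
-- rows below the row of 1's (i.e. row 3 of F, which is (m_j m_{j+1} - 1)_j).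
PGraph : ∀ n → Frieze n → YFrieze n → Set
PGraph n (f , _) (y , _) = ∀ j → y 1 j ≡ f 3 j

PBijective : ℕ → Set
PBijective n =
  ((F : Frieze n) → ∃ λ (Y : YFrieze n) → PGraph n F Y) ×
  ((F : Frieze n) (Y Y′ : YFrieze n) → PGraph n F Y → PGraph n F Y′ → Y ≈Y Y′) ×
  ((F G : Frieze n) (Y : YFrieze n) → PGraph n F Y → PGraph n G Y → F ≈F G) ×
  ((Y : YFrieze n) → ∃ λ (F : Frieze n) → PGraph n F Y)

-- For a frieze f of any width, y i j = f i (j+1) · f (i+2) j is an
-- arithmetic Y-frieze whose first row is row 3 of f, and a Y-frieze is determined
-- by its first row; this gives a well-defined map.  For width 4 each inner row of f
-- is a quotient of a row of y by a row of f already known, so p₄ is injective.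
-- Surjectivity: the frieze over a Y-frieze y must have rows 2 and 5 equal to the
-- ratios y₂(j−1)/y₄(j−2) and y₃(j)/y₁(j+1), so it suffices that these are integers.
-- Along a diagonal, xₙ = y₂(n+1)/y₄(n) satisfies xₙ xₙ₊₁ = 1 + y₁(n+2) and the affine
-- relations xₙ = y₁(n+2) xₙ₊₂ − y₄(n+1) and xₙ₊₅ = y₄(n+2) xₙ − y₁(n+4); composing them
-- writes xₙ as an integral affine function of xₙ₊₁, so xₙ is a rational root of a
-- monic integral quadratic, hence an integer.  The second ratio is xₙ₊₅ shifted.
module Submission where

open import Defs
open import Data.Integer
  using (ℤ; +_; +[1+_]; -[1+_]; +0; 0ℤ; 1ℤ; _+_; _-_; _*_; -_; _<_; +<+; ∣_∣; >-nonZero)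
open import Data.Integer.Properties
  using ( i-j≡0⇒i≡j; *-cancelˡ-≡; *-cancelʳ-≡; pos-*; abs-*; *-comm
        ; *-identityˡ; *-identityʳ; *-zeroˡ; *-zeroʳ; +-identityʳ; +-0-abelianGroup)
open import Algebra.Properties.AbelianGroup +-0-abelianGroup using (∙-cancelˡ)
open import Data.Integer.Tactic.RingSolver using (solve-∀)
open import Data.Nat as ℕ using (ℕ; suc; zero; z≤n; s≤s; _∸_)
import Data.Nat.Properties as ℕ
open import Data.Nat.Coprimality using (Coprime; coprime-/gcd; coprime-divisor)
import Data.Nat.Coprimality as Coprimality
open import Data.Nat.Divisibility using (divides; ∣-refl) renaming (_∣_ to _∣ⁿ_)
open import Data.Nat.DivMod using (m/n*n≡m)
open import Data.Nat.GCD using (gcd; gcd[m,n]∣m; gcd[m,n]∣n; gcd[m,n]≢0)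
open import Data.Product using (∃-syntax; _×_; _,_; proj₁; proj₂)
open import Data.Sum using (inj₁)
open import Data.Unit using (tt)
open import Function using (_$_)
open import Relation.Nullary.Decidable using (True; toWitness)
open import Relation.Binary.PropositionalEquality

*-pos : ∀ {x y} → 0ℤ < x → 0ℤ < y → 0ℤ < x * y
*-pos {+[1+ _ ]} {+[1+ _ ]} _ _ = +<+ (s≤s z≤n)
*-pos {+0} (+<+ ())
*-pos {+[1+ _ ]} {+0} _ (+<+ ())

1+-pos : ∀ {x} → 0ℤ < x → 0ℤ < 1ℤ + x
1+-pos {+[1+ _ ]} _ = +<+ (s≤s z≤n)
1+-pos {+0} (+<+ ())

*-pos⁻¹ˡ : ∀ {x y} → 0ℤ < y → 0ℤ < x * y → 0ℤ < x
*-pos⁻¹ˡ {+[1+ _ ]} _ _ = +<+ (s≤s z≤n)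
*-pos⁻¹ˡ {+0} {+[1+ _ ]} _ (+<+ ())
*-pos⁻¹ˡ { -[1+ _ ]} {+[1+ _ ]} _ ()
*-pos⁻¹ˡ {_} {+0} (+<+ ()) _

*-cancelˡ-pos : ∀ k {x y} → 0ℤ < k → k * x ≡ k * y → x ≡ y
*-cancelˡ-pos k {x} {y} k>0 = *-cancelˡ-≡ k x y {{>-nonZero k>0}}

common-factorˡ : ∀ {k k′ x x′} → 0ℤ < k → k ≡ k′ → k * x ≡ k′ * x′ → x ≡ x′
common-factorˡ k>0 refl = *-cancelˡ-pos _ k>0

common-factorʳ : ∀ {k k′ x x′} → 0ℤ < k → k ≡ k′ → x * k ≡ x′ * k′ → x ≡ x′
common-factorʳ {k} {x = x} {x′} k>0 refl = *-cancelʳ-≡ x x′ k {{>-nonZero k>0}}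

-- To derive l = r from hypotheses uᵢ = vᵢ it suffices to exhibit l − r as a
-- combination Σ kᵢ (uᵢ − vᵢ); that exhibition is a ring identity.
combine₁ : ∀ {l r u₁ v₁} k₁ → l - r ≡ k₁ * (u₁ - v₁) → u₁ ≡ v₁ → l ≡ r
combine₁ {l} {r} {u₁} k₁ e refl = i-j≡0⇒i≡j l r (trans e (vanish k₁ u₁))
  where
  vanish : ∀ k₁ u₁ → k₁ * (u₁ - u₁) ≡ 0ℤ
  vanish = solve-∀

combine₂ : ∀ {l r u₁ v₁ u₂ v₂} k₁ k₂ →
           l - r ≡ k₁ * (u₁ - v₁) + k₂ * (u₂ - v₂) → u₁ ≡ v₁ → u₂ ≡ v₂ → l ≡ r
combine₂ {l} {r} {u₁} {_} {u₂} k₁ k₂ e refl refl = i-j≡0⇒i≡j l r (trans e (vanish k₁ u₁ k₂ u₂))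
  where
  vanish : ∀ k₁ u₁ k₂ u₂ → k₁ * (u₁ - u₁) + k₂ * (u₂ - u₂) ≡ 0ℤ
  vanish = solve-∀

combine₃ : ∀ {l r u₁ v₁ u₂ v₂ u₃ v₃} k₁ k₂ k₃ →
           l - r ≡ k₁ * (u₁ - v₁) + k₂ * (u₂ - v₂) + k₃ * (u₃ - v₃) →
           u₁ ≡ v₁ → u₂ ≡ v₂ → u₃ ≡ v₃ → l ≡ r
combine₃ {l} {r} {u₁} {_} {u₂} {_} {u₃} k₁ k₂ k₃ e refl refl refl =
  i-j≡0⇒i≡j l r (trans e (vanish k₁ u₁ k₂ u₂ k₃ u₃))
  where
  vanish : ∀ k₁ u₁ k₂ u₂ k₃ u₃ → k₁ * (u₁ - u₁) + k₂ * (u₂ - u₂) + k₃ * (u₃ - u₃) ≡ 0ℤ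
  vanish = solve-∀

unimodular-square : ∀ p q r s u v → p * q - u ≡ 1ℤ → r * s - v ≡ 1ℤ →
                    (p * r) * (q * s) ≡ (1ℤ + u) * (1ℤ + v)
unimodular-square p q r s u v h₁ h₂ =
  combine₂ (1ℤ + v) (p * q) (identity p q r s u v) h₁ h₂
  where
  identity : ∀ p q r s u v → (p * r) * (q * s) - (1ℤ + u) * (1ℤ + v)
             ≡ (1ℤ + v) * ((p * q - u) - 1ℤ) + (p * q) * ((r * s - v) - 1ℤ)
  identity = solve-∀

quotient-product : ∀ {b₀ b₁ K} m₀ e₀ m₁ e₁ → 0ℤ < e₀ * e₁ →
                   b₀ ≡ m₀ * e₀ → b₁ ≡ m₁ * e₁ → b₀ * b₁ ≡ K * (e₀ * e₁) → m₀ * m₁ ≡ K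
quotient-product {K = K} m₀ e₀ m₁ e₁ e₀e₁>0 refl refl b₀b₁≡K =
  *-cancelˡ-pos (e₀ * e₁) e₀e₁>0 (begin
    e₀ * e₁ * (m₀ * m₁)    ≡⟨ regroup e₀ e₁ m₀ m₁ ⟩
    m₀ * e₀ * (m₁ * e₁)    ≡⟨ b₀b₁≡K ⟩
    K * (e₀ * e₁)          ≡⟨ *-comm K (e₀ * e₁) ⟩
    e₀ * e₁ * K            ∎)
  where
  open ≡-Reasoning
  regroup : ∀ e₀ e₁ m₀ m₁ → e₀ * e₁ * (m₀ * m₁) ≡ m₀ * e₀ * (m₁ * e₁)
  regroup = solve-∀

unimodular-of : ∀ {x} u v → x ≡ 1ℤ + u * v → x - u * v ≡ 1ℤ
unimodular-of u v refl = cancel (u * v)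
  where
  cancel : ∀ w → 1ℤ + w - w ≡ 1ℤ
  cancel = solve-∀

coprime-∣-square⇒≡1 : ∀ {s r} → Coprime s r → s ∣ⁿ r ℕ.* r → s ≡ 1
coprime-∣-square⇒≡1 coprime s∣r² = coprime (∣-refl , coprime-divisor coprime s∣r²)

-- A rational number N/D (N, D > 0) that is a root of the monic polynomial
-- X² − L X − K is an integer.
monic-root-integral : ∀ {N D} K L → 0ℤ < N → 0ℤ < D →
                      N * N ≡ D * (K * D + L * N) → ∃[ q ] N ≡ q * D
monic-root-integral {+0} _ _ (+<+ ()) _ _
monic-root-integral {+[1+ _ ]} {+0} _ _ _ (+<+ ()) _
monic-root-integral {+[1+ n ]} {+[1+ d ]} K L _ _ eq = + r , N≡r*D
  where
  g : ℕ
  g = gcd (suc n) (suc d)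
  instance
    g≢0 : ℕ.NonZero g
    g≢0 = ℕ.≢-nonZero (gcd[m,n]≢0 (suc n) (suc d) (inj₁ λ ()))
  r s : ℕ
  r = suc n ℕ./ g
  s = suc d ℕ./ g
  N≡rg : +[1+ n ] ≡ + r * + g
  N≡rg = trans (cong +_ (sym (m/n*n≡m (gcd[m,n]∣m (suc n) (suc d))))) (pos-* r g)
  D≡sg : +[1+ d ] ≡ + s * + g
  D≡sg = trans (cong +_ (sym (m/n*n≡m (gcd[m,n]∣n (suc n) (suc d))))) (pos-* s g)
  g²>0 : 0ℤ < + g * + g
  g²>0 = *-pos (+<+ (ℕ.>-nonZero⁻¹ g)) (+<+ (ℕ.>-nonZero⁻¹ g))
  Z : ℤ
  Z = K * + s + L * + r
  r²≡sZ : + r * + r ≡ + s * Z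
  r²≡sZ = *-cancelˡ-pos (+ g * + g) g²>0 (combine₁ 1ℤ (scale (+ r) (+ s) (+ g) K L)
            (subst₂ (λ x y → x * x ≡ y * (K * y + L * x)) N≡rg D≡sg eq))
    where
    scale : ∀ r s g K L → g * g * (r * r) - g * g * (s * (K * s + L * r))
                        ≡ 1ℤ * ((r * g) * (r * g) - (s * g) * (K * (s * g) + L * (r * g)))
    scale = solve-∀
  s≡1 : s ≡ 1
  s≡1 = coprime-∣-square⇒≡1 (Coprimality.sym (coprime-/gcd (suc n) (suc d)))
          (divides ∣ Z ∣ (trans (sym (abs-* (+ r) (+ r)))
                         (trans (cong ∣_∣ r²≡sZ) (trans (abs-* (+ s) Z) (ℕ.*-comm s ∣ Z ∣)))))
  N≡r*D : +[1+ n ] ≡ + r * +[1+ d ]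
  N≡r*D = trans N≡rg (cong (+ r *_) (sym (trans D≡sg (trans (cong (λ t → + t * + g) s≡1) (*-identityˡ (+ g))))))

-- N₁/D₁ = α · N₂/D₂ + β, with the denominators cleared.
record RatioAffine (N₁ D₁ α N₂ D₂ β : ℤ) : Set where
  constructor ratio-affine
  field cleared : N₁ * D₂ ≡ α * N₂ * D₁ + β * D₁ * D₂

open RatioAffine using (cleared)

ratio-affine-∘ : ∀ {N₁ D₁ α N₂ D₂ β N₃ D₃ γ δ} → 0ℤ < D₂ →
                 RatioAffine N₁ D₁ α N₂ D₂ β → RatioAffine N₂ D₂ γ N₃ D₃ δ →
                 RatioAffine N₁ D₁ (α * γ) N₃ D₃ (α * δ + β)
ratio-affine-∘ {N₁} {D₁} {α} {N₂} {D₂} {β} {N₃} {D₃} {γ} {δ} D₂>0 (ratio-affine h₁) (ratio-affine h₂) =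
  ratio-affine $ *-cancelˡ-pos D₂ D₂>0 (combine₂ D₃ (α * D₁) (identity N₁ N₂ N₃ D₁ D₂ D₃ α β γ δ) h₁ h₂)
  where
  identity : ∀ N₁ N₂ N₃ D₁ D₂ D₃ α β γ δ →
    D₂ * (N₁ * D₃) - D₂ * ((α * γ) * N₃ * D₁ + (α * δ + β) * D₁ * D₃)
    ≡ D₃ * (N₁ * D₂ - (α * N₂ * D₁ + β * D₁ * D₂)) + (α * D₁) * (N₂ * D₃ - (γ * N₃ * D₂ + δ * D₂ * D₃))
  identity = solve-∀

-- If x = A y + B and x y = K then x² = A K + B x, so x is integral over ℤ.
ratio-integral : ∀ {N₁ D₁ A N₂ D₂ B} K → 0ℤ < N₁ → 0ℤ < D₁ → 0ℤ < D₂ →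
                 RatioAffine N₁ D₁ A N₂ D₂ B → N₁ * N₂ ≡ K * D₁ * D₂ → ∃[ q ] N₁ ≡ q * D₁
ratio-integral {N₁} {D₁} {A} {N₂} {D₂} {B} K N₁>0 D₁>0 D₂>0 (ratio-affine affine) product =
  monic-root-integral (A * K) B N₁>0 D₁>0
    (*-cancelˡ-pos D₂ D₂>0 (combine₂ N₁ (A * D₁) (identity N₁ N₂ D₁ D₂ A B K) affine product))
  where
  identity : ∀ N₁ N₂ D₁ D₂ A B K →
    D₂ * (N₁ * N₁) - D₂ * (D₁ * (A * K * D₁ + B * N₁))
    ≡ N₁ * (N₁ * D₂ - (A * N₂ * D₁ + B * D₁ * D₂)) + (A * D₁) * (N₁ * N₂ - K * D₁ * D₂)
  identity = solve-∀

-- Four consecutive rows 1..4 of a width-4 Y-frieze, read along a half-line of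
-- positions: a n = y₁(w+n), …, e n = y₄(w+n).
record YStrip : Set where
  field
    a b c e  : ℕ → ℤ
    a>0      : ∀ n → 0ℤ < a n
    b>0      : ∀ n → 0ℤ < b n
    c>0      : ∀ n → 0ℤ < c n
    e>0      : ∀ n → 0ℤ < e n
    diamond₁ : ∀ n → a n * a (suc n) ≡ 1ℤ + b n
    diamond₂ : ∀ n → b n * b (suc n) ≡ (1ℤ + a (suc n)) * (1ℤ + c n)
    diamond₃ : ∀ n → c n * c (suc n) ≡ (1ℤ + b (suc n)) * (1ℤ + e n)
    diamond₄ : ∀ n → e n * e (suc n) ≡ 1ℤ + c (suc n)

-- The lemmas relate the ratios xₙ = b₍ₙ₊₁₎ / eₙ and zₙ = c₍ₙ₊₂₎ / a₍ₙ₊₃₎.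
module YStripProperties (S : YStrip) where
  open YStrip S

  x-product : ∀ n → b (1 ℕ.+ n) * b (2 ℕ.+ n) ≡ (1ℤ + a (2 ℕ.+ n)) * e n * e (1 ℕ.+ n)
  x-product n = combine₂ 1ℤ (- (1ℤ + a (2 ℕ.+ n)))
    (identity (b (1 ℕ.+ n)) (b (2 ℕ.+ n)) (a (2 ℕ.+ n)) (c (1 ℕ.+ n)) (e n) (e (1 ℕ.+ n)))
    (diamond₂ (1 ℕ.+ n)) (diamond₄ n)
    where
    identity : ∀ b₁ b₂ a₂ c₁ e₀ e₁ → b₁ * b₂ - (1ℤ + a₂) * e₀ * e₁
               ≡ 1ℤ * (b₁ * b₂ - (1ℤ + a₂) * (1ℤ + c₁)) + (- (1ℤ + a₂)) * (e₀ * e₁ - (1ℤ + c₁))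
    identity = solve-∀

  x-by-x₊₂ : ∀ n → RatioAffine (b (1 ℕ.+ n)) (e n) (a (2 ℕ.+ n)) (b (3 ℕ.+ n)) (e (2 ℕ.+ n)) (- e (1 ℕ.+ n))
  x-by-x₊₂ n = ratio-affine $ *-cancelˡ-pos (b (2 ℕ.+ n)) (b>0 (2 ℕ.+ n))
    (combine₃ (e (2 ℕ.+ n)) (- (a (2 ℕ.+ n) * e n)) (- (e n * e (1 ℕ.+ n) * e (2 ℕ.+ n)))
       (identity (b (1 ℕ.+ n)) (b (2 ℕ.+ n)) (b (3 ℕ.+ n)) (a (2 ℕ.+ n))
                 (a (3 ℕ.+ n)) (e n) (e (1 ℕ.+ n)) (e (2 ℕ.+ n)))
       (x-product n) (x-product (1 ℕ.+ n)) (diamond₁ (2 ℕ.+ n)))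
    where
    identity : ∀ b₁ b₂ b₃ a₂ a₃ e₀ e₁ e₂ →
      b₂ * (b₁ * e₂) - b₂ * (a₂ * b₃ * e₀ + (- e₁) * e₀ * e₂)
      ≡ e₂ * (b₁ * b₂ - (1ℤ + a₂) * e₀ * e₁) + (- (a₂ * e₀)) * (b₂ * b₃ - (1ℤ + a₃) * e₁ * e₂)
        + (- (e₀ * e₁ * e₂)) * (a₂ * a₃ - (1ℤ + b₂))
    identity = solve-∀

  x₊₂-by-x : ∀ n → RatioAffine (b (3 ℕ.+ n)) (e (2 ℕ.+ n)) (a (3 ℕ.+ n)) (b (1 ℕ.+ n)) (e n) (- e (1 ℕ.+ n))
  x₊₂-by-x n = ratio-affine $ *-cancelˡ-pos (b (2 ℕ.+ n)) (b>0 (2 ℕ.+ n))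
    (combine₃ (- (a (3 ℕ.+ n) * e (2 ℕ.+ n))) (e n) (- (e n * e (1 ℕ.+ n) * e (2 ℕ.+ n)))
       (identity (b (1 ℕ.+ n)) (b (2 ℕ.+ n)) (b (3 ℕ.+ n)) (a (2 ℕ.+ n))
                 (a (3 ℕ.+ n)) (e n) (e (1 ℕ.+ n)) (e (2 ℕ.+ n)))
       (x-product n) (x-product (1 ℕ.+ n)) (diamond₁ (2 ℕ.+ n)))
    where
    identity : ∀ b₁ b₂ b₃ a₂ a₃ e₀ e₁ e₂ →
      b₂ * (b₃ * e₀) - b₂ * (a₃ * b₁ * e₂ + (- e₁) * e₂ * e₀)
      ≡ (- (a₃ * e₂)) * (b₁ * b₂ - (1ℤ + a₂) * e₀ * e₁) + e₀ * (b₂ * b₃ - (1ℤ + a₃) * e₁ * e₂)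
        + (- (e₀ * e₁ * e₂)) * (a₂ * a₃ - (1ℤ + b₂))
    identity = solve-∀

  z-product : ∀ n → c (2 ℕ.+ n) * c (3 ℕ.+ n) ≡ (1ℤ + e (2 ℕ.+ n)) * a (3 ℕ.+ n) * a (4 ℕ.+ n)
  z-product n = combine₂ 1ℤ (- (1ℤ + e (2 ℕ.+ n)))
    (identity (c (2 ℕ.+ n)) (c (3 ℕ.+ n)) (a (3 ℕ.+ n)) (a (4 ℕ.+ n)) (b (3 ℕ.+ n)) (e (2 ℕ.+ n)))
    (diamond₃ (2 ℕ.+ n)) (diamond₁ (3 ℕ.+ n))
    where
    identity : ∀ c₂ c₃ a₃ a₄ b₃ e₂ → c₂ * c₃ - (1ℤ + e₂) * a₃ * a₄
               ≡ 1ℤ * (c₂ * c₃ - (1ℤ + b₃) * (1ℤ + e₂)) + (- (1ℤ + e₂)) * (a₃ * a₄ - (1ℤ + b₃))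
    identity = solve-∀

  z-by-x₊₃ : ∀ n → RatioAffine (c (2 ℕ.+ n)) (a (3 ℕ.+ n)) (e (1 ℕ.+ n)) (b (4 ℕ.+ n)) (e (3 ℕ.+ n)) (- a (2 ℕ.+ n))
  z-by-x₊₃ n = ratio-affine $ combine₃ 1ℤ (e (3 ℕ.+ n)) (- e (3 ℕ.+ n))
    (identity (c (2 ℕ.+ n)) (a (2 ℕ.+ n)) (a (3 ℕ.+ n)) (b (2 ℕ.+ n))
              (b (4 ℕ.+ n)) (e (1 ℕ.+ n)) (e (2 ℕ.+ n)) (e (3 ℕ.+ n)))
    (cleared (x-by-x₊₂ (1 ℕ.+ n))) (diamond₁ (2 ℕ.+ n)) (diamond₄ (1 ℕ.+ n))
    where
    identity : ∀ c₂ a₂ a₃ b₂ b₄ e₁ e₂ e₃ →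
      c₂ * e₃ - (e₁ * b₄ * a₃ + (- a₂) * a₃ * e₃)
      ≡ 1ℤ * (b₂ * e₃ - (a₃ * b₄ * e₁ + (- e₂) * e₁ * e₃)) + e₃ * (a₂ * a₃ - (1ℤ + b₂))
        + (- e₃) * (e₁ * e₂ - (1ℤ + c₂))
    identity = solve-∀

  z-by-x : ∀ n → RatioAffine (c (2 ℕ.+ n)) (a (3 ℕ.+ n)) (e (2 ℕ.+ n)) (b (1 ℕ.+ n)) (e n) (- a (4 ℕ.+ n))
  z-by-x n = ratio-affine $ combine₃ 1ℤ (e n) (- e n)
    (identity (c (2 ℕ.+ n)) (a (3 ℕ.+ n)) (a (4 ℕ.+ n)) (b (1 ℕ.+ n))
              (b (3 ℕ.+ n)) (e n) (e (1 ℕ.+ n)) (e (2 ℕ.+ n)))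
    (cleared (x₊₂-by-x n)) (diamond₁ (3 ℕ.+ n)) (diamond₄ (1 ℕ.+ n))
    where
    identity : ∀ c₂ a₃ a₄ b₁ b₃ e₀ e₁ e₂ →
      c₂ * e₀ - (e₂ * b₁ * a₃ + (- a₄) * a₃ * e₀)
      ≡ 1ℤ * (b₃ * e₀ - (a₃ * b₁ * e₂ + (- e₁) * e₂ * e₀)) + e₀ * (a₃ * a₄ - (1ℤ + b₃))
        + (- e₀) * (e₁ * e₂ - (1ℤ + c₂))
    identity = solve-∀

  x₊₅-z₊₁-product : ∀ n → b (6 ℕ.+ n) * c (3 ℕ.+ n) ≡ (1ℤ + e (2 ℕ.+ n)) * e (5 ℕ.+ n) * a (4 ℕ.+ n)
  x₊₅-z₊₁-product n = *-cancelˡ-pos (e (3 ℕ.+ n) * a (5 ℕ.+ n)) (*-pos (e>0 (3 ℕ.+ n)) (a>0 (5 ℕ.+ n)))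
    (combine₃ (- c (3 ℕ.+ n)) (e (5 ℕ.+ n)) (- (a (4 ℕ.+ n) * a (5 ℕ.+ n) * e (5 ℕ.+ n)))
       (identity (b (6 ℕ.+ n)) (c (3 ℕ.+ n)) (c (4 ℕ.+ n)) (a (4 ℕ.+ n))
                 (a (5 ℕ.+ n)) (e (2 ℕ.+ n)) (e (3 ℕ.+ n)) (e (5 ℕ.+ n)))
       (cleared (z-by-x₊₃ (2 ℕ.+ n))) (z-product (1 ℕ.+ n)) (diamond₄ (2 ℕ.+ n)))
    where
    identity : ∀ b₆ c₃ c₄ a₄ a₅ e₂ e₃ e₅ →
      e₃ * a₅ * (b₆ * c₃) - e₃ * a₅ * ((1ℤ + e₂) * e₅ * a₄)
      ≡ (- c₃) * (c₄ * e₅ - (e₃ * b₆ * a₅ + (- a₄) * a₅ * e₅)) + e₅ * (c₃ * c₄ - (1ℤ + e₃) * a₄ * a₅)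
        + (- (a₄ * a₅ * e₅)) * (e₂ * e₃ - (1ℤ + c₃))
    identity = solve-∀

  x₊₅≡z : ∀ n → b (6 ℕ.+ n) * a (3 ℕ.+ n) ≡ c (2 ℕ.+ n) * e (5 ℕ.+ n)
  x₊₅≡z n = *-cancelˡ-pos (c (3 ℕ.+ n)) (c>0 (3 ℕ.+ n))
    (combine₂ (a (3 ℕ.+ n)) (- e (5 ℕ.+ n))
       (identity (b (6 ℕ.+ n)) (c (2 ℕ.+ n)) (c (3 ℕ.+ n)) (a (3 ℕ.+ n))
                 (a (4 ℕ.+ n)) (e (2 ℕ.+ n)) (e (5 ℕ.+ n)))
       (x₊₅-z₊₁-product n) (z-product n))
    where
    identity : ∀ b₆ c₂ c₃ a₃ a₄ e₂ e₅ →
      c₃ * (b₆ * a₃) - c₃ * (c₂ * e₅)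
      ≡ a₃ * (b₆ * c₃ - (1ℤ + e₂) * e₅ * a₄) + (- e₅) * (c₂ * c₃ - (1ℤ + e₂) * a₃ * a₄)
    identity = solve-∀

  x₊₅-by-x : ∀ n → RatioAffine (b (6 ℕ.+ n)) (e (5 ℕ.+ n)) (e (2 ℕ.+ n)) (b (1 ℕ.+ n)) (e n) (- a (4 ℕ.+ n))
  x₊₅-by-x n = ratio-affine $ *-cancelˡ-pos (a (3 ℕ.+ n)) (a>0 (3 ℕ.+ n))
    (combine₂ (e n) (e (5 ℕ.+ n))
       (identity (b (1 ℕ.+ n)) (b (6 ℕ.+ n)) (c (2 ℕ.+ n)) (a (3 ℕ.+ n))
                 (a (4 ℕ.+ n)) (e n) (e (2 ℕ.+ n)) (e (5 ℕ.+ n)))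
       (x₊₅≡z n) (cleared (z-by-x n)))
    where
    identity : ∀ b₁ b₆ c₂ a₃ a₄ e₀ e₂ e₅ →
      a₃ * (b₆ * e₀) - a₃ * (e₂ * b₁ * e₅ + (- a₄) * e₅ * e₀)
      ≡ e₀ * (b₆ * a₃ - c₂ * e₅) + e₅ * (c₂ * e₀ - (e₂ * b₁ * a₃ + (- a₄) * a₃ * e₀))
    identity = solve-∀

  -- Chaining xₙ → xₙ₊₂ → xₙ₊₄ → xₙ₊₆ → xₙ₊₁ writes xₙ affinely in xₙ₊₁, while xₙ xₙ₊₁ ∈ ℤ.
  e∣b : ∀ n → ∃[ q ] b (1 ℕ.+ n) ≡ q * e n
  e∣b n = ratio-integral (1ℤ + a (2 ℕ.+ n)) (b>0 (1 ℕ.+ n)) (e>0 n) (e>0 (1 ℕ.+ n))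
            (ratio-affine-∘ (e>0 (2 ℕ.+ n)) (x-by-x₊₂ n)
              (ratio-affine-∘ (e>0 (4 ℕ.+ n)) (x-by-x₊₂ (2 ℕ.+ n))
                (ratio-affine-∘ (e>0 (6 ℕ.+ n)) (x-by-x₊₂ (4 ℕ.+ n)) (x₊₅-by-x (1 ℕ.+ n)))))
            (x-product n)

  a∣c : ∀ n → ∃[ q ] c (2 ℕ.+ n) ≡ q * a (3 ℕ.+ n)
  a∣c n = q , *-cancelˡ-pos (e (5 ℕ.+ n)) (e>0 (5 ℕ.+ n))
    (combine₂ (- 1ℤ) (a (3 ℕ.+ n)) (identity (b (6 ℕ.+ n)) (c (2 ℕ.+ n)) (a (3 ℕ.+ n)) (e (5 ℕ.+ n)) q)
       (x₊₅≡z n) b≡qe)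
    where
    q : ℤ
    q = proj₁ (e∣b (5 ℕ.+ n))
    b≡qe : b (6 ℕ.+ n) ≡ q * e (5 ℕ.+ n)
    b≡qe = proj₂ (e∣b (5 ℕ.+ n))
    identity : ∀ b₆ c₂ a₃ e₅ q → e₅ * c₂ - e₅ * (q * a₃) ≡ (- 1ℤ) * (b₆ * a₃ - c₂ * e₅) + a₃ * (b₆ - q * e₅)
    identity = solve-∀

module FriezeToY {n : ℕ} (F : Frieze n) where
  f : ℕ → ℤ → ℤ
  f = proj₁ F
  open IsFrieze (proj₂ F)

  y : ℕ → ℤ → ℤ
  y i j = f i (j + 1ℤ) * f (2 ℕ.+ i) j

  private
    row-bounds : ∀ {k} → suc k ℕ.≤ n → suc k ℕ.≤ n ℕ.+ 2 × 3 ℕ.+ k ℕ.≤ n ℕ.+ 2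
    row-bounds {k} k<n = ℕ.≤-trans k<n (ℕ.m≤m+n n 2)
                       , subst (ℕ._≤ n ℕ.+ 2) (ℕ.+-comm (suc k) 2) (ℕ.+-monoˡ-≤ 2 k<n)

  diamond : ∀ i j → 1 ℕ.≤ i → i ℕ.≤ n →
            y i j * y i (j + 1ℤ) ≡ (1ℤ + y (i ∸ 1) (j + 1ℤ)) * (1ℤ + y (suc i) j)
  diamond (suc k) j _ k<n =
    unimodular-square (f (suc k) (j + 1ℤ)) (f (suc k) (j + 1ℤ + 1ℤ)) (f (3 ℕ.+ k) j) (f (3 ℕ.+ k) (j + 1ℤ)) _ _
                      (unimod (suc k) (j + 1ℤ) (s≤s z≤n) (proj₁ (row-bounds k<n)))
                      (unimod (3 ℕ.+ k) j (s≤s z≤n) (proj₂ (row-bounds k<n)))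

  y-positive : ∀ i j → 1 ℕ.≤ i → i ℕ.≤ n → 0ℤ < y i j
  y-positive (suc k) j _ k<n = *-pos (positive (suc k) _ (s≤s z≤n) (proj₁ (row-bounds k<n)))
                                     (positive (3 ℕ.+ k) _ (s≤s z≤n) (proj₂ (row-bounds k<n)))

  isYFrieze : IsYFrieze n y
  isYFrieze = record
    { row0     = λ j → trans (cong (_* f 2 j) (row0 (j + 1ℤ))) (*-zeroˡ (f 2 j))
    ; rowLast  = λ j → trans (cong (f (suc n) (j + 1ℤ) *_) (subst (λ i → f i j ≡ 0ℤ) (ℕ.+-comm n 3) (rowZeros j)))
                             (*-zeroʳ (f (suc n) (j + 1ℤ)))
    ; diamond  = diamond
    ; positive = y-positive
    }

  y₁≡f₃ : ∀ j → y 1 j ≡ f 3 j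
  y₁≡f₃ j = trans (cong (_* f 3 j) (row1 (j + 1ℤ))) (*-identityˡ (f 3 j))

toYFrieze : ∀ {n} → Frieze n → YFrieze n
toYFrieze F = FriezeToY.y F , FriezeToY.isYFrieze F

-- Row i+2 is read off rows i and i+1 by the diamond rule, dividing by 1 + y i (j+1) > 0.
YFrieze-determined-by-row₁ : ∀ {n} (Y Y′ : YFrieze n) → (∀ j → proj₁ Y 1 j ≡ proj₁ Y′ 1 j) → Y ≈Y Y′
YFrieze-determined-by-row₁ {n} (y , isY) (y′ , isY′) row₁ = rows
  where
  module I = IsYFrieze isY
  module I′ = IsYFrieze isY′

  RowsAgree : ℕ → Set
  RowsAgree i = ∀ j → y i j ≡ y′ i j

  1+y>0 : ∀ i j → i ℕ.≤ n → 0ℤ < 1ℤ + y i j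
  1+y>0 zero    j _   rewrite I.row0 j = +<+ (s≤s z≤n)
  1+y>0 (suc i) j i<n = 1+-pos (I.positive (suc i) j (s≤s z≤n) i<n)

  next : ∀ i → suc i ℕ.≤ n → RowsAgree i → RowsAgree (suc i) → RowsAgree (2 ℕ.+ i)
  next i i<n rᵢ rᵢ₊₁ j =
    ∙-cancelˡ 1ℤ _ _ (*-cancelˡ-pos (1ℤ + y i (j + 1ℤ)) (1+y>0 i _ (ℕ.≤-trans (ℕ.n≤1+n i) i<n)) (begin
      (1ℤ + y i (j + 1ℤ)) * (1ℤ + y (2 ℕ.+ i) j)    ≡⟨ sym (I.diamond (suc i) j (s≤s z≤n) i<n) ⟩
      y (suc i) j * y (suc i) (j + 1ℤ)               ≡⟨ cong₂ _*_ (rᵢ₊₁ j) (rᵢ₊₁ (j + 1ℤ)) ⟩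
      y′ (suc i) j * y′ (suc i) (j + 1ℤ)             ≡⟨ I′.diamond (suc i) j (s≤s z≤n) i<n ⟩
      (1ℤ + y′ i (j + 1ℤ)) * (1ℤ + y′ (2 ℕ.+ i) j)  ≡⟨ cong (λ t → (1ℤ + t) * (1ℤ + y′ (2 ℕ.+ i) j)) (sym (rᵢ (j + 1ℤ))) ⟩
      (1ℤ + y i (j + 1ℤ)) * (1ℤ + y′ (2 ℕ.+ i) j)   ∎))
    where open ≡-Reasoning

  consecutive : ∀ i → i ℕ.≤ n → RowsAgree i × RowsAgree (suc i)
  consecutive zero    _   = (λ j → trans (I.row0 j) (sym (I′.row0 j))) , row₁
  consecutive (suc i) i<n with consecutive i (ℕ.≤-trans (ℕ.n≤1+n i) i<n)
  ... | rᵢ , rᵢ₊₁ = rᵢ₊₁ , next i i<n rᵢ rᵢ₊₁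

  rows : ∀ i j → i ℕ.≤ suc n → y i j ≡ y′ i j
  rows zero    j _       = proj₁ (consecutive 0 z≤n) j
  rows (suc i) j (s≤s i≤n) = proj₂ (consecutive i i≤n) j

auto≤ : ∀ {m n} {{_ : True (m ℕ.≤? n)}} → m ℕ.≤ n
auto≤ {{m≤n}} = toWitness m≤n

-1+1 : ∀ j → j - 1ℤ + 1ℤ ≡ j
-1+1 = solve-∀

+1-1 : ∀ j → j + 1ℤ - 1ℤ ≡ j
+1-1 = solve-∀

from-successors : ∀ {P : ℤ → Set} → (∀ k → P (k + 1ℤ)) → ∀ j → P j
from-successors {P} h j = subst P (-1+1 j) (h (j - 1ℤ))

along : ∀ (R : ℤ → ℤ → Set) → (∀ j → R j (j + 1ℤ)) → ∀ w n → R (w + + n) (w + + suc n)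
along R r w n = subst (R (w + + n)) (step w (+ n)) (r (w + + n))
  where
  step : ∀ w k → w + k + 1ℤ ≡ w + (1ℤ + k)
  step = solve-∀

module YToFrieze (Y : YFrieze 4) where
  y : ℕ → ℤ → ℤ
  y = proj₁ Y
  open IsYFrieze (proj₂ Y)

  y>0 : ∀ i {{_ : True (1 ℕ.≤? i)}} {{_ : True (i ℕ.≤? 4)}} j → 0ℤ < y i j
  y>0 i j = positive i j auto≤ auto≤

  diamond₁ : ∀ j → y 1 j * y 1 (j + 1ℤ) ≡ 1ℤ + y 2 j
  diamond₁ j = trans (diamond 1 j auto≤ auto≤)
                 (trans (cong (λ t → (1ℤ + t) * (1ℤ + y 2 j)) (row0 (j + 1ℤ))) (*-identityˡ _))

  diamond₂ : ∀ j → y 2 j * y 2 (j + 1ℤ) ≡ (1ℤ + y 1 (j + 1ℤ)) * (1ℤ + y 3 j)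
  diamond₂ j = diamond 2 j auto≤ auto≤

  diamond₃ : ∀ j → y 3 j * y 3 (j + 1ℤ) ≡ (1ℤ + y 2 (j + 1ℤ)) * (1ℤ + y 4 j)
  diamond₃ j = diamond 3 j auto≤ auto≤

  diamond₄ : ∀ j → y 4 j * y 4 (j + 1ℤ) ≡ 1ℤ + y 3 (j + 1ℤ)
  diamond₄ j = trans (diamond 4 j auto≤ auto≤)
                 (trans (cong (λ t → (1ℤ + y 3 (j + 1ℤ)) * (1ℤ + t)) (rowLast j)) (*-identityʳ _))

  strip : ℤ → YStrip
  strip w = record
    { a = λ n → y 1 (w + + n) ; b = λ n → y 2 (w + + n) ; c = λ n → y 3 (w + + n) ; e = λ n → y 4 (w + + n)
    ; a>0 = λ n → y>0 1 _ ; b>0 = λ n → y>0 2 _ ; c>0 = λ n → y>0 3 _ ; e>0 = λ n → y>0 4 _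
    ; diamond₁ = along (λ j k → y 1 j * y 1 k ≡ 1ℤ + y 2 j) diamond₁ w
    ; diamond₂ = along (λ j k → y 2 j * y 2 k ≡ (1ℤ + y 1 k) * (1ℤ + y 3 j)) diamond₂ w
    ; diamond₃ = along (λ j k → y 3 j * y 3 k ≡ (1ℤ + y 2 k) * (1ℤ + y 4 j)) diamond₃ w
    ; diamond₄ = along (λ j k → y 4 j * y 4 k ≡ 1ℤ + y 3 k) diamond₄ w
    }

  y₄∣y₂ : ∀ j → ∃[ q ] y 2 j ≡ q * y 4 (j - 1ℤ)
  y₄∣y₂ j = proj₁ e∣b , subst₂ (λ s t → y 2 s ≡ proj₁ e∣b * y 4 t) (-1+1 j) (+-identityʳ (j - 1ℤ)) (proj₂ e∣b)
    where
    e∣b : ∃[ q ] y 2 (j - 1ℤ + 1ℤ) ≡ q * y 4 (j - 1ℤ + 0ℤ)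
    e∣b = YStripProperties.e∣b (strip (j - 1ℤ)) 0

  y₁∣y₃ : ∀ j → ∃[ q ] y 3 j ≡ q * y 1 (j + 1ℤ)
  y₁∣y₃ j = proj₁ a∣c , subst₂ (λ s t → y 3 s ≡ proj₁ a∣c * y 1 t) (-2+2 j) (-2+3 j) (proj₂ a∣c)
    where
    a∣c : ∃[ q ] y 3 (j - + 2 + + 2) ≡ q * y 1 (j - + 2 + + 3)
    a∣c = YStripProperties.a∣c (strip (j - + 2)) 0
    -2+2 : ∀ j → j - + 2 + + 2 ≡ j
    -2+2 = solve-∀
    -2+3 : ∀ j → j - + 2 + + 3 ≡ j + 1ℤ
    -2+3 = solve-∀

  -- Opaque: unfolding the quotients produced by the divisibility proofs makes
  -- conversion checking blow up.
  opaque
    m : ℤ → ℤ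
    m k = proj₁ (y₄∣y₂ (k - 1ℤ))

    m-spec : ∀ k → y 2 (k - 1ℤ) ≡ m k * y 4 (k - 1ℤ - 1ℤ)
    m-spec k = proj₂ (y₄∣y₂ (k - 1ℤ))

    p : ℤ → ℤ
    p j = proj₁ (y₁∣y₃ j)

    y₃≡p*y₁ : ∀ j → y 3 j ≡ p j * y 1 (j + 1ℤ)
    y₃≡p*y₁ j = proj₂ (y₁∣y₃ j)

  y₂≡m*y₄ : ∀ j → y 2 j ≡ m (j + 1ℤ) * y 4 (j - 1ℤ)
  y₂≡m*y₄ j = subst (λ t → y 2 t ≡ m (j + 1ℤ) * y 4 (t - 1ℤ)) (+1-1 j) (m-spec (j + 1ℤ))

  m>0 : ∀ k → 0ℤ < m k
  m>0 k = *-pos⁻¹ˡ (y>0 4 _) (subst (0ℤ <_) (m-spec k) (y>0 2 _))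

  p>0 : ∀ j → 0ℤ < p j
  p>0 j = *-pos⁻¹ˡ (y>0 1 _) (subst (0ℤ <_) (y₃≡p*y₁ j) (y>0 3 _))

  y₄-product : ∀ j → y 4 (j - 1ℤ) * y 4 j ≡ 1ℤ + y 3 j
  y₄-product = from-successors λ k →
    subst (λ t → y 4 t * y 4 (k + 1ℤ) ≡ 1ℤ + y 3 (k + 1ℤ)) (sym (+1-1 k)) (diamond₄ k)

  m-product : ∀ j → m j * m (j + 1ℤ) ≡ 1ℤ + y 1 j
  m-product = from-successors λ k → quotient-product (m (k + 1ℤ)) (y 4 (k - 1ℤ)) (m (k + 1ℤ + 1ℤ)) (y 4 k)
    (*-pos (y>0 4 _) (y>0 4 _))
    (y₂≡m*y₄ k)
    (subst (λ t → y 2 (k + 1ℤ) ≡ m (k + 1ℤ + 1ℤ) * y 4 t) (+1-1 k) (y₂≡m*y₄ (k + 1ℤ)))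
    (trans (diamond₂ k) (cong ((1ℤ + y 1 (k + 1ℤ)) *_) (sym (y₄-product k))))

  p-product : ∀ j → p j * p (j + 1ℤ) ≡ 1ℤ + y 4 j
  p-product j = quotient-product (p j) (y 1 (j + 1ℤ)) (p (j + 1ℤ)) (y 1 (j + 1ℤ + 1ℤ))
    (*-pos (y>0 1 _) (y>0 1 _)) (y₃≡p*y₁ j) (y₃≡p*y₁ (j + 1ℤ))
    (trans (diamond₃ j) (trans (*-comm (1ℤ + y 2 (j + 1ℤ)) (1ℤ + y 4 j))
                               (cong ((1ℤ + y 4 j) *_) (sym (diamond₁ (j + 1ℤ))))))

  f : ℕ → ℤ → ℤ
  f 0 _ = 0ℤ
  f 1 _ = 1ℤ
  f 2 j = m j
  f 3 j = y 1 j
  f 4 j = y 4 (j - 1ℤ)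
  f 5 j = p j
  f 6 _ = 1ℤ
  f _ _ = 0ℤ

  unimodular : ∀ i j → 1 ℕ.≤ i → i ℕ.≤ 6 → f i j * f i (j + 1ℤ) - f (i ∸ 1) (j + 1ℤ) * f (suc i) j ≡ 1ℤ
  unimodular 1 j _ _ = unimodular-of 0ℤ (m j) refl
  unimodular 2 j _ _ =
    unimodular-of 1ℤ (y 1 j) (trans (m-product j) (cong (_+_ 1ℤ) (sym (*-identityˡ (y 1 j)))))
  unimodular 3 j _ _ =
    unimodular-of (m (j + 1ℤ)) (y 4 (j - 1ℤ)) (trans (diamond₁ j) (cong (_+_ 1ℤ) (y₂≡m*y₄ j)))
  unimodular 4 j _ _ rewrite +1-1 j =
    unimodular-of (y 1 (j + 1ℤ)) (p j)
      (trans (y₄-product j) (cong (_+_ 1ℤ) (trans (y₃≡p*y₁ j) (*-comm (p j) (y 1 (j + 1ℤ))))))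
  unimodular 5 j _ _ rewrite +1-1 j =
    unimodular-of (y 4 j) 1ℤ (trans (p-product j) (cong (_+_ 1ℤ) (sym (*-identityʳ (y 4 j)))))
  unimodular 6 j _ _ = unimodular-of (p (j + 1ℤ)) 0ℤ (cong (_+_ 1ℤ) (sym (*-zeroʳ (p (j + 1ℤ)))))
  unimodular (suc (suc (suc (suc (suc (suc (suc _))))))) j _ (s≤s (s≤s (s≤s (s≤s (s≤s (s≤s ()))))))

  f>0 : ∀ i j → 1 ℕ.≤ i → i ℕ.≤ 6 → 0ℤ < f i j
  f>0 1 j _ _ = +<+ (s≤s z≤n)
  f>0 2 j _ _ = m>0 j
  f>0 3 j _ _ = y>0 1 j
  f>0 4 j _ _ = y>0 4 _
  f>0 5 j _ _ = p>0 j
  f>0 6 j _ _ = +<+ (s≤s z≤n)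
  f>0 (suc (suc (suc (suc (suc (suc (suc _))))))) j _ (s≤s (s≤s (s≤s (s≤s (s≤s (s≤s ()))))))

  frieze : Frieze 4
  frieze = f , record
    { row0 = λ _ → refl ; row1 = λ _ → refl ; rowOnes = λ _ → refl ; rowZeros = λ _ → refl
    ; unimod = unimodular ; positive = f>0 }

-- Each inner row of a width-4 frieze is a factor of an entry of its Y-frieze,
-- the complementary factor coming from a row already known.
Frieze₄-determined-by-row₃ : (F G : Frieze 4) → (∀ j → proj₁ F 3 j ≡ proj₁ G 3 j) → F ≈F G
Frieze₄-determined-by-row₃ F@(f , isF) G@(g , isG) row₃ = rows
  where
  module F = IsFrieze isF
  module G = IsFrieze isG

  sameY : toYFrieze F ≈Y toYFrieze G
  sameY = YFrieze-determined-by-row₁ (toYFrieze F) (toYFrieze G)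
            (λ j → trans (FriezeToY.y₁≡f₃ F j) (trans (row₃ j) (sym (FriezeToY.y₁≡f₃ G j))))

  f>0 : ∀ i {{_ : True (1 ℕ.≤? i)}} {{_ : True (i ℕ.≤? 6)}} j → 0ℤ < f i j
  f>0 i j = F.positive i j auto≤ auto≤

  row₄ : ∀ j → f 4 j ≡ g 4 j
  row₄ = from-successors λ k →
    common-factorʳ (f>0 6 k) (trans (F.rowOnes k) (sym (G.rowOnes k))) (sameY 4 k auto≤)

  row₅ : ∀ j → f 5 j ≡ g 5 j
  row₅ j = common-factorˡ (f>0 3 _) (row₃ (j + 1ℤ)) (sameY 3 j auto≤)

  row₂ : ∀ j → f 2 j ≡ g 2 j
  row₂ = from-successors λ k → common-factorʳ (f>0 4 k) (row₄ k) (sameY 2 k auto≤)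

  rows : ∀ i j → i ℕ.≤ 7 → f i j ≡ g i j
  rows 0 j _ = trans (F.row0 j) (sym (G.row0 j))
  rows 1 j _ = trans (F.row1 j) (sym (G.row1 j))
  rows 2 j _ = row₂ j
  rows 3 j _ = row₃ j
  rows 4 j _ = row₄ j
  rows 5 j _ = row₅ j
  rows 6 j _ = trans (F.rowOnes j) (sym (G.rowOnes j))
  rows 7 j _ = trans (F.rowZeros j) (sym (G.rowZeros j))
  rows (suc (suc (suc (suc (suc (suc (suc (suc _)))))))) j (s≤s (s≤s (s≤s (s≤s (s≤s (s≤s (s≤s ())))))))

corollary3p8 : PBijective 4
corollary3p8 =
    (λ F → toYFrieze F , FriezeToY.y₁≡f₃ F)
  , (λ F Y Y′ h h′ → YFrieze-determined-by-row₁ Y Y′ (λ j → trans (h j) (sym (h′ j))))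
  , (λ F G Y h h′ → Frieze₄-determined-by-row₃ F G (λ j → trans (sym (h j)) (h′ j)))
  , (λ Y → YToFrieze.frieze Y , λ j → refl)
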